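{- Let $G$ be a connected graph and let $A, B$ be two linked, disjoint and saturated subsets of $V(G)$. Let $S$ be (the vertex set of) a connected component of $G - N[A\cup B]$. Then for every $v\in S$, $N(S)\subseteq \mathrm{cl}(A\cup\{v\})\cap\mathrm{cl}(B\cup\{v\})\cap N(A\cup B)$.
   Context: All graphs are finite, undirected and loopless. For $X\subseteq V(G)$, $N(X)=\{u\in V(G)\setminus X : u\text{ adjacent to some }x\in X\}$, $N[X]=N(X)\cup X$, and $G-X$ is the subgraph induced by $V(G)\setminus X$. A chordless $uv$-path is a $uv$-path that is an induced subgraph. A set $C$ is convex if for all $u,v\in C$ every vertex on a chordless $uv$-path lies in $C$; $\mathrm{cl}(X)$ is the intersection of all convex sets containing $X$. $A,B$ are linked if some vertex of $A$ is adjacent to some vertex of $B$. $A/B=\{v : \mathrm{cl}(B\cup\{v\})\cap A\ne\emptyset\}$. A set $X\subseteq V(G)\setminus(A\cup B)$ is forbidden if $\mathrm{cl}(X)$ meets both $A$ and $B$; $\mathrm{mfs}(A,B)$ is the family of inclusion-minimal forbidden sets. $\sigma(A,B)=\mathrm{cl}\big(A/B\cup\bigcup\{\bigcap_{x\in X}\mathrm{cl}(A\cup\{x\}) : X\in\mathrm{mfs}(A,B)\}\big)$; $S(A,B)=\bigcup_{i\ge0}\sigma(A_i,B_i)$ with $A_0=A$, $B_0=B$, $A_i=\sigma(A_{i-1},B_{i-1})$, $B_i=\sigma(B_{i-1},A_{i-1})$; $A,B$ are saturated if $A=S(A,B)$ and $B=S(B,A)$. -}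

module Defs where

open import Data.Nat using (ℕ; zero; suc)
open import Data.Fin using (Fin; zero; suc; toℕ; fromℕ; inject₁)
open import Data.Fin.Subset using (Subset; _∈_; _⊆_)
open import Data.Bool using (Bool; T)
open import Data.Product using (Σ; ∃; _×_; _,_)
open import Data.Sum using (_⊎_)
open import Data.Empty using (⊥)
open import Relation.Nullary using (¬_)
open import Relation.Binary.PropositionalEquality using (_≡_)

record Graph (n : ℕ) : Set where
  field
    adj    : Fin n → Fin n → Bool
    sym    : ∀ u v → adj u v ≡ adj v u
    irrefl : ∀ u → ¬ T (adj u u)

module _ {n : ℕ} (G : Graph n) where
  open Graph G

  Adj : Fin n → Fin n → Set
  Adj u v = T (adj u v)

  VSet : Set₁
  VSet = Fin n → Set

  ⟦_⟧ : Subset n → VSet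
  ⟦ X ⟧ v = v ∈ X

  _∪ˢ_ : VSet → VSet → VSet
  (P ∪ˢ Q) v = P v ⊎ Q v

  ｛_｝ : Fin n → VSet
  ｛ x ｝ v = v ≡ x

  Nbh : VSet → VSet
  Nbh X u = ¬ X u × ∃ λ x → X x × Adj u x

  NbhC : VSet → VSet
  NbhC X = X ∪ˢ Nbh X

  IsWalk : (u v : Fin n) (k : ℕ) → (Fin (suc k) → Fin n) → Set
  IsWalk u v k p =
    p zero ≡ u × p (fromℕ k) ≡ v × (∀ (i : Fin k) → Adj (p (inject₁ i)) (p (suc i)))

  IsChordlessPath : (u v : Fin n) (k : ℕ) → (Fin (suc k) → Fin n) → Set
  IsChordlessPath u v k p =
    IsWalk u v k p
    × (∀ i j → p i ≡ p j → i ≡ j)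
    × (∀ i j → Adj (p i) (p j) → toℕ i ≡ suc (toℕ j) ⊎ toℕ j ≡ suc (toℕ i))

  Convex : Subset n → Set
  Convex C = ∀ u v (k : ℕ) (p : Fin (suc k) → Fin n) →
    u ∈ C → v ∈ C → IsChordlessPath u v k p → ∀ i → p i ∈ C

  cl : VSet → VSet
  cl X v = ∀ (C : Subset n) → Convex C → (∀ x → X x → x ∈ C) → v ∈ C

  Connected : Set
  Connected = ∀ u v → ∃ λ k → Σ (Fin (suc k) → Fin n) λ p → IsWalk u v k p

  Linked : VSet → VSet → Set
  Linked A B = ∃ λ a → ∃ λ b → A a × B b × Adj a b

  Disjoint : VSet → VSet → Set
  Disjoint A B = ∀ v → A v → B v → ⊥

  _／_ : VSet → VSet → VSet
  (A ／ B) v = ∃ λ a → A a × cl (B ∪ˢ ｛ v ｝) a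

  Forbidden : VSet → VSet → Subset n → Set
  Forbidden A B X =
    (∀ x → x ∈ X → ¬ A x × ¬ B x)
    × (∃ λ a → A a × cl ⟦ X ⟧ a)
    × (∃ λ b → B b × cl ⟦ X ⟧ b)

  Mfs : VSet → VSet → Subset n → Set
  Mfs A B X = Forbidden A B X × (∀ (Y : Subset n) → Y ⊆ X → Forbidden A B Y → X ⊆ Y)

  σ : VSet → VSet → VSet
  σ A B = cl ((A ／ B) ∪ˢ
     (λ v → ∃ λ (X : Subset n) → Mfs A B X × (∀ x → x ∈ X → cl (A ∪ˢ ｛ x ｝) v)))

  iter : VSet → VSet → ℕ → VSet × VSet
  iter A B zero = A , B
  iter A B (suc i) with iter A B i
  ... | (Ai , Bi) = σ Ai Bi , σ Bi Ai

  Sat : VSet → VSet → VSet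
  Sat A B v = ∃ λ i → (let (Ai , Bi) = iter A B i in σ Ai Bi v)

  _≐_ : VSet → VSet → Set
  P ≐ Q = ∀ v → (P v → Q v) × (Q v → P v)

  Saturated : VSet → VSet → Set
  Saturated A B = (A ≐ Sat A B) × (B ≐ Sat B A)

  IsComponentOfMinus : VSet → Subset n → Set
  IsComponentOfMinus X S =
    (∃ λ s → s ∈ S)
    × (∀ s → s ∈ S → ¬ X s)
    × (∀ u v → u ∈ S → v ∈ S → ∃ λ k → Σ (Fin (suc k) → Fin n) λ p →
          IsWalk u v k p × (∀ i → p i ∈ S))
    × (∀ u s → s ∈ S → Adj u s → ¬ X u → u ∈ S)

{-# OPTIONS --safe #-}
-- Saturated sets contain every chordless path between two of their members, so A and B are
-- convex. Let u ∈ N(S) be adjacent to s ∈ S. By maximality of the component, u ∈ N(A ∪ B), say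
-- u ~ x. The walk v ⇝ s inside S, then s u x, then (if x ∈ B) x ⇝ b₀ inside the convex, hence
-- connected, set B followed by a linking edge b₀a₀, ends in A and stays inside S ∪ {u} ∪ A ∪ B.
-- Shortening it to a chordless path keeps it there, and since S has no neighbour in A ∪ B the
-- path can only leave S through u; so u lies on a chordless path from v to A, i.e. in
-- cl(A ∪ {v}). The same argument with A and B swapped gives u ∈ cl(B ∪ {v}).
module Submission where

open import Defs
open import Data.Nat using (ℕ; zero; suc)
open import Data.Nat.Properties using (suc-injective)
open import Data.Fin using (Fin; zero; suc; toℕ; inject₁)
open import Data.Fin.Properties using (any?) renaming (_≟_ to _≟ᶠ_; suc-injective to sucᶠ-injective)
open import Data.Fin.Subset using (Subset; _∈_)
open import Data.Fin.Subset.Properties using (_∈?_)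
open import Data.Vec.Functional using (_∷_; tail)
open import Data.Bool using (T)
open import Data.Product using (_×_; _,_; ∃; Σ; proj₁; proj₂; map₂)
open import Data.Sum using (_⊎_; inj₁; inj₂) renaming (map to ⊎-map; swap to ⊎-swap)
open import Data.Unit using (⊤; tt)
open import Data.Empty using (⊥-elim)
open import Function using (_∘_)
open import Relation.Nullary using (¬_; Dec; yes; no)
open import Relation.Nullary.Decidable using (_×-dec_; _⊎-dec_; T?)
open import Relation.Binary.PropositionalEquality using (_≡_; refl; sym; cong; subst)
open import Relation.Binary.Construct.Closure.ReflexiveTransitive using (Star; ε; _◅_; _◅◅_)
  renaming (map to Star-map)

module _ {n : ℕ} (G : Graph n) where

  Adj-sym : ∀ {x y} → Adj G x y → Adj G y x
  Adj-sym {x} {y} = subst T (Graph.sym G x y)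

  Near : Fin n → Fin n → Set
  Near x y = x ≡ y ⊎ Adj G x y

  near? : ∀ x y → Dec (Near x y)
  near? x y = (x ≟ᶠ y) ⊎-dec T? (Graph.adj G x y)

  WalkIn : VSet G → Fin n → Fin n → Set
  WalkIn P = Star (λ x y → Adj G x y × P y)

  ChordlessPathIn : VSet G → Fin n → Fin n → Set
  ChordlessPathIn P x y =
    ∃ λ k → Σ (Fin (suc k) → Fin n) λ p → IsChordlessPath G x y k p × (∀ i → P (p i))

  walkIn-mono : ∀ {P Q : VSet G} → (∀ {w} → P w → Q w) → ∀ {x y} → WalkIn P x y → WalkIn Q x y
  walkIn-mono P⊆Q = Star-map (map₂ P⊆Q)

  isWalk-tail : ∀ {x y k p} → IsWalk G x y (suc k) p → IsWalk G (p (suc zero)) y k (tail p)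
  isWalk-tail (_ , end , step) = refl , end , step ∘ suc

  isWalk⇒walkIn : ∀ {P : VSet G} {x y k p} → IsWalk G x y k p → (∀ i → P (p i)) → WalkIn P x y
  isWalk⇒walkIn {k = zero}  (refl , refl , _) _ = ε
  isWalk⇒walkIn {k = suc k} {p} walk@(refl , _ , step) inP =
    (step zero , inP (suc zero)) ◅ isWalk⇒walkIn (isWalk-tail {p = p} walk) (inP ∘ suc)

  trivialChordlessPath : ∀ x → IsChordlessPath G x x 0 (λ _ → x)
  trivialChordlessPath x =
    (refl , refl , λ ()) , (λ { zero zero _ → refl }) , λ { zero zero xx → ⊥-elim (Graph.irrefl G x xx) }

  isChordlessPath-tail : ∀ {x y k p} → IsChordlessPath G x y (suc k) p →
    IsChordlessPath G (p (suc zero)) y k (tail p)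
  isChordlessPath-tail {p = p} (walk , injective , chordless) =
    isWalk-tail {p = p} walk ,
    (λ i j → sucᶠ-injective ∘ injective (suc i) (suc j)) ,
    (λ i j → ⊎-map suc-injective suc-injective ∘ chordless (suc i) (suc j))

  isChordlessPath-∷ : ∀ {x y z k p} → Adj G x (p zero) → (∀ i → ¬ Near x (p (suc i))) →
    IsChordlessPath G y z k p → IsChordlessPath G x z (suc k) (x ∷ p)
  isChordlessPath-∷ {x} {k = k} {p} xp₀ far ((_ , end , step) , injective , chordless) =
    (refl , end , step′) , injective′ , chordless′
    where
      x≢p₀ : ¬ x ≡ p zero
      x≢p₀ x≡p₀ = Graph.irrefl G x (subst (Adj G x) (sym x≡p₀) xp₀)

      step′ : ∀ i → Adj G ((x ∷ p) (inject₁ i)) ((x ∷ p) (suc i))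
      step′ zero    = xp₀
      step′ (suc i) = step i

      injective′ : ∀ i j → (x ∷ p) i ≡ (x ∷ p) j → i ≡ j
      injective′ zero          zero          _  = refl
      injective′ zero          (suc zero)    eq = ⊥-elim (x≢p₀ eq)
      injective′ zero          (suc (suc j)) eq = ⊥-elim (far j (inj₁ eq))
      injective′ (suc zero)    zero          eq = ⊥-elim (x≢p₀ (sym eq))
      injective′ (suc (suc i)) zero          eq = ⊥-elim (far i (inj₁ (sym eq)))
      injective′ (suc i)       (suc j)       eq = cong suc (injective i j eq)

      chordless′ : ∀ i j → Adj G ((x ∷ p) i) ((x ∷ p) j) → toℕ i ≡ suc (toℕ j) ⊎ toℕ j ≡ suc (toℕ i)
      chordless′ zero          zero          xx = ⊥-elim (Graph.irrefl G x xx)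
      chordless′ zero          (suc zero)    _  = inj₂ refl
      chordless′ zero          (suc (suc j)) e  = ⊥-elim (far j (inj₂ e))
      chordless′ (suc zero)    zero          _  = inj₁ refl
      chordless′ (suc (suc i)) zero          e  = ⊥-elim (far i (inj₂ (Adj-sym e)))
      chordless′ (suc i)       (suc j)       e  = ⊎-map (cong suc) (cong suc) (chordless i j e)

  prependNearHead : ∀ {P : VSet G} {x y z k p} → P x → Near x (p zero) → (∀ i → ¬ Near x (p (suc i))) →
    IsChordlessPath G y z k p → (∀ i → P (p i)) → ChordlessPathIn P x z
  prependNearHead _ (inj₁ refl) _ ((_ , walk) , path) inP = _ , _ , ((refl , walk) , path) , inP
  prependNearHead {k = k} {p} px (inj₂ xp₀) far path inP =
    suc k , _ , isChordlessPath-∷ {p = p} xp₀ far path , λ { zero → px ; (suc i) → inP i }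

  -- x followed by p cut at its last vertex near x (just that suffix if this vertex is x itself).
  prependNear : ∀ {P : VSet G} {x y z k p} → P x → (∃ λ i → Near x (p i)) →
    IsChordlessPath G y z k p → (∀ i → P (p i)) → ChordlessPathIn P x z
  prependNear {k = zero} px (zero , near) path inP = prependNearHead px near (λ ()) path inP
  prependNear {x = x} {k = suc k} {p} px near path inP with any? (λ i → near? x (p (suc i)))
  ... | yes nearTail = prependNear px nearTail (isChordlessPath-tail {p = p} path) (inP ∘ suc)
  ... | no farTail with near
  ...   | zero , nearHead = prependNearHead px nearHead (λ i → farTail ∘ (i ,_)) path inP
  ...   | suc i , nearTail = ⊥-elim (farTail (i , nearTail))

  walkIn⇒chordlessPathIn : ∀ {P : VSet G} {x y} → P x → WalkIn P x y → ChordlessPathIn P x y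
  walkIn⇒chordlessPathIn {x = x} px ε = 0 , _ , trivialChordlessPath x , λ _ → px
  walkIn⇒chordlessPathIn px ((xy , py) ◅ w) with walkIn⇒chordlessPathIn py w
  ... | _ , p , path@((start , _) , _) , inP =
    prependNear {p = p} px (zero , inj₂ (subst (Adj G _) (sym start) xy)) path inP

  ⊆cl : ∀ {X : VSet G} {x} → X x → cl G X x
  ⊆cl Xx _ _ X⊆C = X⊆C _ Xx

  cl-chordlessPath : ∀ {X : VSet G} {x y k p} → cl G X x → cl G X y →
    IsChordlessPath G x y k p → ∀ i → cl G X (p i)
  cl-chordlessPath x∈cl y∈cl path i C convex X⊆C =
    convex _ _ _ _ (x∈cl C convex X⊆C) (y∈cl C convex X⊆C) path i

  ⊆σ : ∀ {A B : VSet G} {x} → A x → σ G A B x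
  ⊆σ {x = x} Ax = ⊆cl (inj₁ (x , Ax , ⊆cl (inj₂ refl)))

  saturated⇒convex : ∀ {A B : Subset n} → _≐_ G (_∈ A) (Sat G (_∈ A) (_∈ B)) → Convex G A
  saturated⇒convex {B = B} A≐Sat x y k p xA yA path i =
    proj₂ (A≐Sat (p i)) (0 , cl-chordlessPath (⊆σ {B = _∈ B} xA) (⊆σ yA) path i)

  convex⇒walkIn : Connected G → ∀ {C : Subset n} → Convex G C →
    ∀ {x y} → x ∈ C → y ∈ C → WalkIn (_∈ C) x y
  convex⇒walkIn connected convex {x} {y} xC yC with connected x y
  ... | _ , q , walk with walkIn⇒chordlessPathIn {P = λ _ → ⊤} tt (isWalk⇒walkIn {p = q} walk _)
  ...   | k , p , path , _ = isWalk⇒walkIn {p = p} (proj₁ path) (convex x y k p xC yC path)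

  isWalk-crossesBoundary : ∀ {S : Subset n} {x y k p} → IsWalk G x y k p →
    x ∈ S → ¬ y ∈ S → ∃ λ i → Nbh G (_∈ S) (p i)
  isWalk-crossesBoundary {k = zero} (refl , refl , _) xS y∉S = ⊥-elim (y∉S xS)
  isWalk-crossesBoundary {S = S} {k = suc k} {p} walk@(refl , _ , step) xS y∉S
    with p (suc zero) ∈? S
  ... | no p₁∉S = suc zero , p₁∉S , p zero , xS , Adj-sym (step zero)
  ... | yes p₁S with isWalk-crossesBoundary (isWalk-tail {p = p} walk) p₁S y∉S
  ...   | i , boundary = suc i , boundary

  isWalk-passesThrough : ∀ {S : Subset n} {X : VSet G} {u x y k p} →
    (∀ {s w} → s ∈ S → X w → ¬ Adj G s w) →
    IsWalk G x y k p → (∀ i → p i ∈ S ⊎ p i ≡ u ⊎ X (p i)) →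
    x ∈ S → ¬ y ∈ S → ∃ λ i → p i ≡ u
  isWalk-passesThrough noEdge walk inP xS y∉S with isWalk-crossesBoundary walk xS y∉S
  ... | i , pᵢ∉S , s , sS , pᵢs with inP i
  ...   | inj₁ pᵢS          = ⊥-elim (pᵢ∉S pᵢS)
  ...   | inj₂ (inj₁ pᵢ≡u)  = i , pᵢ≡u
  ...   | inj₂ (inj₂ Xpᵢ)   = ⊥-elim (noEdge sS Xpᵢ (Adj-sym pᵢs))

  ¬NbhC⇒¬Adj : ∀ {X : VSet G} {s w} → ¬ NbhC G X s → X w → ¬ Adj G s w
  ¬NbhC⇒¬Adj s∉N[X] Xw sw = s∉N[X] (inj₂ (s∉N[X] ∘ inj₁ , _ , Xw , sw))

  component-boundary⊆Nbh : ∀ {X : VSet G} {S} → (∀ w → Dec (X w)) →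
    IsComponentOfMinus G (NbhC G X) S → ∀ {u} → Nbh G (_∈ S) u → Nbh G X u
  component-boundary⊆Nbh {X} X? (_ , avoids , _ , maximal) {u} (u∉S , s , sS , us) = ¬Xu , neighbour
    where
      ¬Xu : ¬ X u
      ¬Xu Xu = ¬NbhC⇒¬Adj (avoids s sS) Xu (Adj-sym us)

      neighbour : ∃ λ w → X w × Adj G u w
      neighbour with any? (λ w → X? w ×-dec T? (Graph.adj G u w))
      ... | yes found = found
      ... | no none   = ⊥-elim (u∉S (maximal u s sS us
                          λ { (inj₁ Xu) → ¬Xu Xu ; (inj₂ (_ , found)) → none found }))

  walkThroughBoundaryToA : ∀ {A B S : Subset n} → Connected G → Convex G B → Linked G (_∈ A) (_∈ B) →
    (∀ {s t} → s ∈ S → t ∈ S → WalkIn (_∈ S) s t) →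
    ∀ {v s u x} → v ∈ S → s ∈ S → Adj G u s → x ∈ A ⊎ x ∈ B → Adj G u x →
    ∃ λ a → a ∈ A × WalkIn (λ w → w ∈ S ⊎ w ≡ u ⊎ w ∈ A ⊎ w ∈ B) v a
  walkThroughBoundaryToA {A} {B} {S} connected convexB (a₀ , b₀ , a₀A , b₀B , a₀b₀) walkS {v} {u = u} {x}
    vS sS us xAB ux = toA xAB
    where
      Around : VSet G
      Around w = w ∈ S ⊎ w ≡ u ⊎ w ∈ A ⊎ w ∈ B

      v⇝x : WalkIn Around v x
      v⇝x = walkIn-mono inj₁ (walkS vS sS) ◅◅ (Adj-sym us , inj₂ (inj₁ refl)) ◅ (ux , inj₂ (inj₂ xAB)) ◅ ε

      toA : x ∈ A ⊎ x ∈ B → ∃ λ a → a ∈ A × WalkIn Around v a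
      toA (inj₁ xA) = x , xA , v⇝x
      toA (inj₂ xB) = a₀ , a₀A ,
        v⇝x ◅◅ walkIn-mono (inj₂ ∘ inj₂ ∘ inj₂) (convex⇒walkIn connected convexB xB b₀B)
            ◅◅ (Adj-sym a₀b₀ , inj₂ (inj₂ (inj₁ a₀A))) ◅ ε

  boundary⊆cl : ∀ {A B S : Subset n} → Connected G → Convex G B → Linked G (_∈ A) (_∈ B) →
    (∀ {s} → s ∈ S → ¬ s ∈ A) → (∀ {s w} → s ∈ S → w ∈ A ⊎ w ∈ B → ¬ Adj G s w) →
    (∀ {s t} → s ∈ S → t ∈ S → WalkIn (_∈ S) s t) →
    ∀ {v u x} → v ∈ S → Nbh G (_∈ S) u → x ∈ A ⊎ x ∈ B → Adj G u x → cl G (λ w → w ∈ A ⊎ w ≡ v) u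
  boundary⊆cl connected convexB linked S∩A=∅ noEdge walkS vS (_ , s , sS , us) xAB ux
    with walkThroughBoundaryToA connected convexB linked walkS vS sS us xAB ux
  ... | a , aA , v⇝a with walkIn⇒chordlessPathIn (inj₁ vS) v⇝a
  ...   | _ , p , path , inP
    with isWalk-passesThrough {p = p} noEdge (proj₁ path) inP vS (λ aS → S∩A=∅ aS aA)
  ...     | i , pᵢ≡u = subst (cl G _) pᵢ≡u (cl-chordlessPath (⊆cl (inj₂ refl)) (⊆cl (inj₁ aA)) path i)

lemma20 : ∀ {n : ℕ} (G : Graph n) (A B S : Subset n) →
    Connected G →
    Linked G (⟦_⟧ G A) (⟦_⟧ G B) →
    Disjoint G (⟦_⟧ G A) (⟦_⟧ G B) →
    Saturated G (⟦_⟧ G A) (⟦_⟧ G B) →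
    IsComponentOfMinus G (NbhC G (_∪ˢ_ G (⟦_⟧ G A) (⟦_⟧ G B))) S →
    ∀ v → v ∈ S → ∀ u → Nbh G (⟦_⟧ G S) u →
      cl G (_∪ˢ_ G (⟦_⟧ G A) (｛_｝ G v)) u
      × cl G (_∪ˢ_ G (⟦_⟧ G B) (｛_｝ G v)) u
      × Nbh G (_∪ˢ_ G (⟦_⟧ G A) (⟦_⟧ G B)) u
lemma20 G A B S connected (a , b , aA , bB , ab) _ (A-saturated , B-saturated)
  component@(_ , avoids , walks , _) v vS u u∈N[S]
  with component-boundary⊆Nbh G (λ w → (w ∈? A) ⊎-dec (w ∈? B)) component u∈N[S]
... | u∈N[A∪B]@(_ , _ , xAB , ux) =
  boundary⊆cl G connected (saturated⇒convex G B-saturated) (a , b , aA , bB , ab)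
    (λ sS → avoids _ sS ∘ inj₁ ∘ inj₁) noEdge walkS vS u∈N[S] xAB ux ,
  boundary⊆cl G connected (saturated⇒convex G A-saturated) (b , a , bB , aA , Adj-sym G ab)
    (λ sS → avoids _ sS ∘ inj₁ ∘ inj₂) (λ sS → noEdge sS ∘ ⊎-swap) walkS vS u∈N[S] (⊎-swap xAB) ux ,
  u∈N[A∪B]
  where
    noEdge : ∀ {s w} → s ∈ S → w ∈ A ⊎ w ∈ B → ¬ Adj G s w
    noEdge sS = ¬NbhC⇒¬Adj G (avoids _ sS)

    walkS : ∀ {s t} → s ∈ S → t ∈ S → WalkIn G (_∈ S) s t
    walkS sS tS with walks _ _ sS tS
    ... | _ , p , walk , inS = isWalk⇒walkIn G {p = p} walk inS
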